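{- For every integer $n\ge 4$, $\psi(SG(n,2))=n-2=\chi(SG(n,2))$.
   Context: The Schrijver graph $SG(n,k)$ has as vertices the $k$-element subsets $A\subseteq\{1,\dots,n\}$ containing no two cyclically consecutive elements (no $\{i,i+1\}$, $1\le i<n$, and not $\{1,n\}$); two vertices are adjacent iff they are disjoint. $\chi$ is the chromatic number. For a graph $G$, $N(v)$ is the neighbourhood of $v$, and the local chromatic number is $\psi(G)=\min_c\max_{v\in V(G)}|\{c(u):u\in N(v)\}|+1$, minimum over all proper colorings $c$ of $G$. -}

module Defs where

open import Data.Nat using (ℕ; zero; suc; _≤_; _<_)
open import Data.Fin using (Fin; toℕ)
open import Data.Fin.Subset using (Subset; _∈_; ∣_∣)
open import Data.List using (List; length)
open import Data.List.Membership.Propositional renaming (_∈_ to _∈ₗ_)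
open import Data.Product using (Σ; ∃; _×_)
open import Data.Sum using (_⊎_)
open import Relation.Nullary using (¬_)
open import Relation.Binary.PropositionalEquality using (_≡_)

record Graph : Set₁ where
  field
    V   : Set
    Adj : V → V → Set
open Graph public

-- Ground set {1,…,n} is represented by Fin n, element i standing for toℕ i + 1.
-- i and j are cyclically consecutive: j = i+1, or {i,j} = {1,n} (with 1 ≠ n).
CycConsec : (n : ℕ) → Fin n → Fin n → Set
CycConsec n i j =
  suc (toℕ i) ≡ toℕ j ⊎ (toℕ i ≡ 0 × suc (toℕ j) ≡ n × 0 < toℕ j)

Stable : (n : ℕ) → Subset n → Set
Stable n A = ∀ i j → i ∈ A → j ∈ A → ¬ CycConsec n i j

Disjoint : {n : ℕ} → Subset n → Subset n → Set
Disjoint A B = ∀ i → i ∈ A → ¬ (i ∈ B)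

SG : ℕ → ℕ → Graph
SG n k = record
  { V   = Σ (Subset n) (λ A → ∣ A ∣ ≡ k × Stable n A)
  ; Adj = λ A B → Disjoint (Data.Product.proj₁ A) (Data.Product.proj₁ B)
  }

Proper : (G : Graph) {C : Set} → (V G → C) → Set
Proper G c = ∀ u v → Adj G u v → ¬ (c u ≡ c v)

IsChromaticNumber : Graph → ℕ → Set
IsChromaticNumber G m =
  Σ (V G → Fin m) (Proper G) ×
  (∀ j → (c : V G → Fin j) → Proper G c → m ≤ j)

-- |{c(u) : u ∈ N(v)}| ≤ t : the neighbour colours are covered by a list of length ≤ t.
NbrColoursAtMost : (G : Graph) → (V G → ℕ) → V G → ℕ → Set
NbrColoursAtMost G c v t =
  Σ (List ℕ) (λ L → length L ≤ t × (∀ u → Adj G v u → c u ∈ₗ L))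

-- |{c(u) : u ∈ N(v)}| ≥ t : there are t neighbours with pairwise distinct colours.
NbrColoursAtLeast : (G : Graph) → (V G → ℕ) → V G → ℕ → Set
NbrColoursAtLeast G c v t =
  Σ (Fin t → V G) (λ f → (∀ i → Adj G v (f i)) × (∀ i j → c (f i) ≡ c (f j) → i ≡ j))

-- ψ(G) = m, i.e. min over proper c of max_v |c(N(v))| + 1 equals m:
--  * some proper colouring has |c(N(v))| + 1 ≤ m for every v, and
--  * every proper colouring has some v with |c(N(v))| + 1 ≥ m.
IsLocalChromaticNumber : Graph → ℕ → Set
IsLocalChromaticNumber G m =
  Σ (V G → ℕ) (λ c → Proper G c × (∀ v → Σ ℕ (λ t → suc t ≤ m × NbrColoursAtMost G c v t))) ×
  (∀ (c : V G → ℕ) → Proper G c →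
     Σ (V G) (λ v → Σ ℕ (λ t → m ≤ suc t × NbrColoursAtLeast G c v t)))

-- Colouring a vertex by its least element is proper, since equally coloured vertices share that
-- element, and uses only n - 2 colours, since a stable pair cannot lie inside {n - 1, n}; so every
-- vertex sees at most the n - 3 colours other than its own.
--
-- For the lower bounds on ψ and χ, view the vertices as the non-consecutive pairs of the n-cycle and
-- show that every proper colouring has a vertex {1, w} with n - 3 neighbours of pairwise distinct
-- colours. Deleting a point of the cycle keeps non-consecutive pairs non-consecutive, which allows
-- induction on n. Delete z = n and get {1, w} with n - 4 such neighbours, none containing z. If some
-- pair {z, y} with y ≠ w has the colour of {z, w}, add it. Otherwise delete w instead, get {1, w′}
-- with n - 4 such neighbours, and add {z, w}: a neighbour containing z differs from it in colour by
-- assumption, and one avoiding z is disjoint from it.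

module Submission where

open import Defs
open import Data.Nat using (ℕ; _≤_; _∸_)
open import Data.Product using (_×_)

open import Data.Nat as ℕ using (zero; suc; _+_; _<_; z≤n; s≤s)
import Data.Nat.Properties as ℕ
open import Data.Fin as Fin using (Fin; zero; suc; toℕ; fromℕ; fromℕ<; punchIn; #_)
open import Data.Fin.Properties
  using (toℕ-injective; toℕ<n; toℕ-fromℕ; toℕ-fromℕ<; punchIn-injective; punchInᵢ≢i; punchIn-punchOut;
         injective⇒≤; any?; all?)
open import Data.Fin.Subset using (Subset; _∈_; _⊆_; ∣_∣; ⁅_⁆; _∪_; inside; outside)
open import Data.Fin.Subset.Properties
  using (_∈?_; x∈⁅x⁆; x∈⁅y⁆⇒x≡y; x∈p∪q⁻; p⊆q⇒∣p∣≤∣q∣; ∣⁅x⁆∣≡1; ∪-comm; ∪-identityˡ; ∪-identityʳ)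
open import Data.Vec.Base using ([]; _∷_; here; there)
open import Data.List using (List; map; allFin)
open import Data.List.Properties using (length-map; length-tabulate)
open import Data.List.Membership.Propositional renaming (_∈_ to _∈ₗ_)
open import Data.List.Membership.Propositional.Properties using (∈-map⁺; ∈-allFin)
open import Data.Product using (Σ; ∃; _,_; proj₁; proj₂)
open import Data.Sum as Sum using (_⊎_; inj₁; inj₂; [_,_]′)
open import Data.Empty using (⊥-elim; ⊥-elim-irr)
open import Function using (_∘_; id)
open import Relation.Nullary using (¬_; Dec; yes; no; contradiction)
open import Relation.Nullary.Decidable using (_×-dec_; _⊎-dec_; _→-dec_; ¬?; recompute; from-yes)
open import Relation.Binary.PropositionalEquality using (_≡_; _≢_; refl; sym; trans; cong; subst)

-- Colour counts in an arbitrary graph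

module _ (G : Graph) where

  toℕ-proper : ∀ {k} {c : V G → Fin k} → Proper G c → Proper G (toℕ ∘ c)
  toℕ-proper c-proper u v u~v = c-proper u v u~v ∘ toℕ-injective

  nbrColoursAtMost-Fin : ∀ {k} (c : V G → Fin (suc k)) → Proper G c →
                         ∀ v → NbrColoursAtMost G (toℕ ∘ c) v k
  nbrColoursAtMost-Fin {k} c c-proper v =
    colours , ℕ.≤-reflexive (trans (length-map _ (allFin k)) (length-tabulate id)) , covered
    where
    colours : List ℕ
    colours = map (toℕ ∘ punchIn (c v)) (allFin k)
    covered : ∀ u → Adj G v u → toℕ (c u) ∈ₗ colours
    covered u v~u =
      subst (_∈ₗ colours) (cong toℕ (punchIn-punchOut (c-proper v u v~u))) (∈-map⁺ _ (∈-allFin _))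

  nbrColoursAtLeast⇒≤ : ∀ {j t} (c : V G → Fin j) → Proper G c → ∀ v →
                        NbrColoursAtLeast G (toℕ ∘ c) v t → suc t ≤ j
  nbrColoursAtLeast⇒≤ {j} {t} c c-proper v (f , v~f , f-distinct) = injective⇒≤ {f = g} g-injective
    where
    g : Fin (suc t) → Fin j
    g zero    = c v
    g (suc i) = c (f i)
    g-injective : ∀ {i i′} → g i ≡ g i′ → i ≡ i′
    g-injective {zero}  {zero}   _ = refl
    g-injective {zero}  {suc i′} e = contradiction e (c-proper v (f i′) (v~f i′))
    g-injective {suc i} {zero}   e = contradiction (sym e) (c-proper v (f i) (v~f i))
    g-injective {suc i} {suc i′} e = cong suc (f-distinct i i′ (cong toℕ e))

-- The n-cycle and its non-consecutive pairs

consec? : ∀ {n} (i j : Fin n) → Dec (CycConsec n i j)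
consec? {n} i j =
  (suc (toℕ i) ℕ.≟ toℕ j) ⊎-dec ((toℕ i ℕ.≟ 0) ×-dec (suc (toℕ j) ℕ.≟ n) ×-dec (0 ℕ.<? toℕ j))

consec-irrefl : ∀ {n} (i : Fin n) → ¬ CycConsec n i i
consec-irrefl i (inj₁ 1+i≡i)           = ℕ.1+n≢n 1+i≡i
consec-irrefl i (inj₂ (i≡0 , _ , 0<i)) = ℕ.<⇒≢ 0<i (sym i≡0)

zero-consec-fromℕ : ∀ n → CycConsec (2 + n) zero (fromℕ (suc n))
zero-consec-fromℕ n = inj₂ (refl , cong (2 +_) (toℕ-fromℕ n) , s≤s z≤n)

stable? : ∀ {n} (A : Subset n) → Dec (Stable n A)
stable? A = all? λ i → all? λ j → i ∈? A →-dec j ∈? A →-dec ¬? (consec? i j)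

toℕ-punchIn-≥ : ∀ {n} (i : Fin (suc n)) (x : Fin n) → toℕ x ≤ toℕ (punchIn i x)
toℕ-punchIn-≥ zero    x       = ℕ.n≤1+n _
toℕ-punchIn-≥ (suc i) zero    = z≤n
toℕ-punchIn-≥ (suc i) (suc x) = s≤s (toℕ-punchIn-≥ i x)

toℕ-punchIn-≤ : ∀ {n} (i : Fin (suc n)) (x : Fin n) → toℕ (punchIn i x) ≤ suc (toℕ x)
toℕ-punchIn-≤ zero    x       = ℕ.≤-refl
toℕ-punchIn-≤ (suc i) zero    = z≤n
toℕ-punchIn-≤ (suc i) (suc x) = s≤s (toℕ-punchIn-≤ i x)

toℕ-punchIn-fromℕ : ∀ n (x : Fin (suc n)) → toℕ (punchIn (fromℕ (suc n)) x) ≡ toℕ x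
toℕ-punchIn-fromℕ n       zero    = refl
toℕ-punchIn-fromℕ (suc n) (suc x) = cong suc (toℕ-punchIn-fromℕ n x)

punchIn-fromℕ : ∀ {n} {i : Fin (2 + n)} → i ≢ fromℕ (suc n) → punchIn i (fromℕ n) ≡ fromℕ (suc n)
punchIn-fromℕ {_}     {zero}        _   = refl
punchIn-fromℕ {zero}  {suc zero}    i≢1 = contradiction refl i≢1
punchIn-fromℕ {suc n} {suc i}       i≢  = cong suc (punchIn-fromℕ (i≢ ∘ cong suc))

punchIn-suc⁻ : ∀ {n} (i : Fin (suc n)) {x y : Fin n} → x ≢ y →
               suc (toℕ (punchIn i x)) ≡ toℕ (punchIn i y) → suc (toℕ x) ≡ toℕ y
punchIn-suc⁻ zero    {x}     {y}     _   e = ℕ.suc-injective e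
punchIn-suc⁻ (suc i) {zero}  {zero}  x≢y _ = contradiction refl x≢y
punchIn-suc⁻ (suc i) {zero}  {suc y} _   e =
  cong suc (sym (ℕ.n≤0⇒n≡0 (subst (toℕ y ≤_) (sym (ℕ.suc-injective e)) (toℕ-punchIn-≥ i y))))
punchIn-suc⁻ (suc i) {suc x} {suc y} x≢y e =
  cong suc (punchIn-suc⁻ i (x≢y ∘ cong suc) (ℕ.suc-injective e))

consec-punchIn⁻ : ∀ {n} (i : Fin (suc n)) {x y : Fin n} → x ≢ y →
                  CycConsec (suc n) (punchIn i x) (punchIn i y) → CycConsec n x y
consec-punchIn⁻ i x≢y (inj₁ e) = inj₁ (punchIn-suc⁻ i x≢y e)
consec-punchIn⁻ {n} i {x} {y} x≢y (inj₂ (i[x]≡0 , 1+i[y]≡1+n , _)) = inj₂ (x≡0 , 1+y≡n , ℕ.n≢0⇒n>0 y≢0)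
  where
  x≡0 : toℕ x ≡ 0
  x≡0 = ℕ.n≤0⇒n≡0 (subst (toℕ x ≤_) i[x]≡0 (toℕ-punchIn-≥ i x))
  1+y≡n : suc (toℕ y) ≡ n
  1+y≡n = ℕ.≤-antisym (toℕ<n y) (subst (_≤ suc (toℕ y)) (ℕ.suc-injective 1+i[y]≡1+n) (toℕ-punchIn-≤ i y))
  y≢0 : toℕ y ≢ 0
  y≢0 y≡0 = x≢y (toℕ-injective (trans x≡0 (sym y≡0)))

Pair : ℕ → Set
Pair n = Fin n × Fin n

Apart : ∀ {n} → Pair n → Set
Apart {n} (x , y) = x ≢ y × ¬ CycConsec n x y × ¬ CycConsec n y x

apart? : ∀ {n} (p : Pair n) → Dec (Apart p)
apart? (x , y) = ¬? (x Fin.≟ y) ×-dec ¬? (consec? x y) ×-dec ¬? (consec? y x)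

apart-sym : ∀ {n} {x y : Fin n} → Apart (x , y) → Apart (y , x)
apart-sym (x≢y , ¬xy , ¬yx) = x≢y ∘ sym , ¬yx , ¬xy

apart-zero⇒≢fromℕ : ∀ {n} {w : Fin (2 + n)} → Apart (zero , w) → w ≢ fromℕ (suc n)
apart-zero⇒≢fromℕ {n} (_ , ¬0w , _) refl = ¬0w (zero-consec-fromℕ n)

apart-fromℕ⇒≢zero : ∀ {n} {y : Fin (2 + n)} → Apart (fromℕ (suc n) , y) → y ≢ zero
apart-fromℕ⇒≢zero {n} (_ , _ , ¬y0) refl = ¬y0 (zero-consec-fromℕ n)

_∉ₚ_ : ∀ {n} → Fin n → Pair n → Set
x ∉ₚ (a , b) = x ≢ a × x ≢ b

DisjointPairs : ∀ {n} → Pair n → Pair n → Set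
DisjointPairs (x , y) q = x ∉ₚ q × y ∉ₚ q

disjointPairs-sym : ∀ {n} {p q : Pair n} → DisjointPairs p q → DisjointPairs q p
disjointPairs-sym ((x≢a , x≢b) , (y≢a , y≢b)) = (x≢a ∘ sym , y≢a ∘ sym) , (x≢b ∘ sym , y≢b ∘ sym)

liftₚ : ∀ {n} → Fin (suc n) → Pair n → Pair (suc n)
liftₚ i (x , y) = punchIn i x , punchIn i y

apart-liftₚ : ∀ {n} (i : Fin (suc n)) {p : Pair n} → Apart p → Apart (liftₚ i p)
apart-liftₚ i (x≢y , ¬xy , ¬yx) =
  x≢y ∘ punchIn-injective i _ _ , ¬xy ∘ consec-punchIn⁻ i x≢y , ¬yx ∘ consec-punchIn⁻ i (x≢y ∘ sym)

∉ₚ-liftₚ : ∀ {n} (i : Fin (suc n)) {x : Fin n} {q : Pair n} → x ∉ₚ q → punchIn i x ∉ₚ liftₚ i q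
∉ₚ-liftₚ i (x≢a , x≢b) = x≢a ∘ punchIn-injective i _ _ , x≢b ∘ punchIn-injective i _ _

∉ₚ-liftₚ-self : ∀ {n} (i : Fin (suc n)) (q : Pair n) → i ∉ₚ liftₚ i q
∉ₚ-liftₚ-self i (a , b) = punchInᵢ≢i i a ∘ sym , punchInᵢ≢i i b ∘ sym

disjointPairs-liftₚ : ∀ {n} (i : Fin (suc n)) {p q : Pair n} →
                      DisjointPairs p q → DisjointPairs (liftₚ i p) (liftₚ i q)
disjointPairs-liftₚ i (x∉q , y∉q) = ∉ₚ-liftₚ i x∉q , ∉ₚ-liftₚ i y∉q

-- Rainbow stars

record PairColouring (n : ℕ) : Set where
  field
    colour    : Pair n → ℕ
    symmetric : ∀ x y → colour (x , y) ≡ colour (y , x)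
    proper    : ∀ {p q} → Apart p → Apart q → DisjointPairs p q → colour p ≢ colour q

open PairColouring

restrict : ∀ {n} → Fin (suc n) → PairColouring (suc n) → PairColouring n
restrict i κ = record
  { colour    = colour κ ∘ liftₚ i
  ; symmetric = λ x y → symmetric κ (punchIn i x) (punchIn i y)
  ; proper    = λ p q d → proper κ (apart-liftₚ i p) (apart-liftₚ i q) (disjointPairs-liftₚ i d)
  }

record Rainbow {n : ℕ} (κ : Pair n → ℕ) (v : Pair n) (t : ℕ) : Set where
  field
    pair      : Fin t → Pair n
    apart     : ∀ i → Apart (pair i)
    disjoint  : ∀ i → DisjointPairs v (pair i)
    injective : ∀ i j → κ (pair i) ≡ κ (pair j) → i ≡ j

open Rainbow

rainbow-liftₚ : ∀ {n t} {κ : Pair (suc n) → ℕ} {v : Pair n} (i : Fin (suc n)) →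
                Rainbow (κ ∘ liftₚ i) v t → Rainbow κ (liftₚ i v) t
rainbow-liftₚ i R = record
  { pair      = liftₚ i ∘ pair R
  ; apart     = apart-liftₚ i ∘ apart R
  ; disjoint  = disjointPairs-liftₚ i ∘ disjoint R
  ; injective = injective R
  }

rainbow-∷ : ∀ {n t} {κ : Pair n → ℕ} {v q : Pair n} (R : Rainbow κ v t) → Apart q → DisjointPairs v q →
            (∀ i → κ (pair R i) ≢ κ q) → Rainbow κ v (suc t)
rainbow-∷ {t = t} {κ} {q = q} R apart-q v#q new = record
  { pair      = pair′
  ; apart     = λ { zero → apart-q ; (suc i) → apart R i }
  ; disjoint  = λ { zero → v#q ; (suc i) → disjoint R i }
  ; injective = injective′
  }
  where
  pair′ : Fin (suc t) → Pair _
  pair′ zero    = q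
  pair′ (suc i) = pair R i
  injective′ : ∀ i j → κ (pair′ i) ≡ κ (pair′ j) → i ≡ j
  injective′ zero    zero    _ = refl
  injective′ zero    (suc j) e = contradiction (sym e) (new j)
  injective′ (suc i) zero    e = contradiction e (new i)
  injective′ (suc i) (suc j) e = cong suc (injective R i j e)

RainbowStar : ∀ {n} → PairColouring (suc n) → ℕ → Set
RainbowStar {n} κ t = Σ (Fin (suc n)) λ w → Apart (zero , w) × Rainbow (colour κ) (zero , w) t

rainbowStar-4 : (κ : PairColouring 4) → RainbowStar κ 1
rainbowStar-4 κ = # 2 , from-yes (apart? {4} (# 0 , # 2)) , record
  { pair      = λ _ → # 1 , # 3
  ; apart     = λ _ → from-yes (apart? {4} (# 1 , # 3))
  ; disjoint  = λ _ → ((λ ()) , (λ ())) , ((λ ()) , (λ ()))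
  ; injective = λ { zero zero _ → refl }
  }

Rival : ∀ {n} → PairColouring n → Fin n → Fin n → Set
Rival κ z w = ∃ λ y → Apart (z , y) × y ≢ w × colour κ (z , y) ≡ colour κ (z , w)

SoleColour : ∀ {n} → PairColouring n → Fin n → Fin n → Set
SoleColour κ z w = ∀ y → Apart (z , y) → y ≢ w → colour κ (z , y) ≢ colour κ (z , w)

rival? : ∀ {n} (κ : PairColouring n) (z w : Fin n) → Rival κ z w ⊎ SoleColour κ z w
rival? κ z w
  with any? (λ y → apart? (z , y) ×-dec ¬? (y Fin.≟ w) ×-dec (colour κ (z , y) ℕ.≟ colour κ (z , w)))
... | yes rival = inj₁ rival
... | no none   = inj₂ λ y zy y≢w same → none (y , zy , y≢w , same)

colour-≢-sole : ∀ {n} (κ : PairColouring n) {z w : Fin n} → SoleColour κ z w → Apart (z , w) →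
                ∀ {q} → Apart q → w ∉ₚ q → colour κ q ≢ colour κ (z , w)
colour-≢-sole κ {z} sole zw {x , y} apart-q (w≢x , w≢y) with x Fin.≟ z | y Fin.≟ z
... | yes refl | _        = sole y apart-q (w≢y ∘ sym)
... | no _     | yes refl = sole x (apart-sym apart-q) (w≢x ∘ sym) ∘ trans (symmetric κ z x)
... | no x≢z   | no y≢z   = proper κ apart-q zw ((x≢z , w≢x ∘ sym) , (y≢z , w≢y ∘ sym))

apart-zero⇒apart-fromℕ : ∀ {n} {w : Fin (2 + n)} → Apart (zero , w) →
                         Apart (fromℕ (2 + n) , punchIn (fromℕ (2 + n)) w)
apart-zero⇒apart-fromℕ {n} {w} (0≢w , ¬0w , _) = punchInᵢ≢i z w ∘ sym , z-not-before , not-before-z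
  where
  z : Fin (3 + n)
  z = fromℕ (2 + n)
  toℕ-w′ : toℕ (punchIn z w) ≡ toℕ w
  toℕ-w′ = toℕ-punchIn-fromℕ (suc n) w
  z-not-before : ¬ CycConsec (3 + n) z (punchIn z w)
  z-not-before (inj₁ e) = ℕ.<⇒≢ (toℕ<n (punchIn z w)) (sym (trans (cong suc (sym (toℕ-fromℕ (2 + n)))) e))
  z-not-before (inj₂ (() , _))
  not-before-z : ¬ CycConsec (3 + n) (punchIn z w) z
  not-before-z (inj₁ e) =
    ¬0w (inj₂ (refl , trans (cong suc (sym toℕ-w′)) (trans e (toℕ-fromℕ (2 + n))) ,
               ℕ.n≢0⇒n>0 (0≢w ∘ toℕ-injective ∘ sym)))
  not-before-z (inj₂ (w′≡0 , _)) = 0≢w (toℕ-injective (sym (trans (sym toℕ-w′) w′≡0)))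

rainbowStar-step : ∀ {n t} → (∀ (κ : PairColouring (2 + n)) → RainbowStar κ t) →
                   (κ : PairColouring (3 + n)) → RainbowStar κ (suc t)
rainbowStar-step {n} {t} ih κ with ih (restrict (fromℕ (2 + n)) κ)
... | zero   , (0≢0 , _) , _  = contradiction refl 0≢0
... | suc w₁ , apart₁    , R₁ = [ keep , move ]′ (rival? κ z w)
  where
  z w : Fin (3 + n)
  z = fromℕ (2 + n)
  w = punchIn z (suc w₁)
  zw : Apart (z , w)
  zw = apart-zero⇒apart-fromℕ apart₁
  R : Rainbow (colour κ) (zero , w) t
  R = rainbow-liftₚ z R₁
  keep : Rival κ z w → RainbowStar κ (suc t)
  keep (y , zy , y≢w , same) = w , apart-liftₚ z apart₁ , rainbow-∷ R zy disjoint-zy new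
    where
    disjoint-zy : DisjointPairs (zero , w) (z , y)
    disjoint-zy = ((λ ()) , apart-fromℕ⇒≢zero zy ∘ sym) , (punchInᵢ≢i z (suc w₁) , y≢w ∘ sym)
    new : ∀ i → colour κ (pair R i) ≢ colour κ (z , y)
    new i e = proper κ (apart R i) zw
      (disjointPairs-sym (∉ₚ-liftₚ-self z (pair R₁ i) , proj₂ (disjoint R i))) (trans e same)
  move : SoleColour κ z w → RainbowStar κ (suc t)
  move sole with ih (restrict w κ)
  ... | w₂ , apart₂ , R₂ = punchIn w w₂ , apart-liftₚ w apart₂ , rainbow-∷ R′ zw disjoint-zw new
    where
    R′ : Rainbow (colour κ) (zero , punchIn w w₂) t
    R′ = rainbow-liftₚ w R₂
    w₂′≢z : punchIn w w₂ ≢ z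
    w₂′≢z e = apart-zero⇒≢fromℕ apart₂
      (punchIn-injective w _ _ (trans e (sym (punchIn-fromℕ (punchInᵢ≢i z (suc w₁))))))
    disjoint-zw : DisjointPairs (zero , punchIn w w₂) (z , w)
    disjoint-zw = ((λ ()) , (λ ())) , (w₂′≢z , punchInᵢ≢i w w₂)
    new : ∀ i → colour κ (pair R′ i) ≢ colour κ (z , w)
    new i = colour-≢-sole κ sole zw (apart R′ i) (∉ₚ-liftₚ-self w (pair R₂ i))

rainbowStar : ∀ k (κ : PairColouring (4 + k)) → RainbowStar κ (suc k)
rainbowStar zero    = rainbowStar-4
rainbowStar (suc k) = rainbowStar-step (rainbowStar k)

-- Pairs as vertices of SG(n,2)

pairSet : ∀ {n} → Pair n → Subset n
pairSet (x , y) = ⁅ x ⁆ ∪ ⁅ y ⁆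

∈-pairSet⁻ : ∀ {n} {i x y : Fin n} → i ∈ pairSet (x , y) → i ≡ x ⊎ i ≡ y
∈-pairSet⁻ {x = x} {y} i∈ = Sum.map (x∈⁅y⁆⇒x≡y x) (x∈⁅y⁆⇒x≡y y) (x∈p∪q⁻ ⁅ x ⁆ ⁅ y ⁆ i∈)

∣pairSet∣≡2 : ∀ {n} {x y : Fin n} → x ≢ y → ∣ pairSet (x , y) ∣ ≡ 2
∣pairSet∣≡2 {x = zero}  {zero}  x≢y = contradiction refl x≢y
∣pairSet∣≡2 {x = zero}  {suc y} _   = cong suc (trans (cong ∣_∣ (∪-identityˡ ⁅ y ⁆)) (∣⁅x⁆∣≡1 y))
∣pairSet∣≡2 {x = suc x} {zero}  _   = cong suc (trans (cong ∣_∣ (∪-identityʳ ⁅ x ⁆)) (∣⁅x⁆∣≡1 x))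
∣pairSet∣≡2 {x = suc x} {suc y} x≢y = ∣pairSet∣≡2 (x≢y ∘ cong suc)

stable-pairSet : ∀ {n} {p : Pair n} → Apart p → Stable n (pairSet p)
stable-pairSet (_ , ¬xy , ¬yx) i j i∈ j∈ with ∈-pairSet⁻ i∈ | ∈-pairSet⁻ j∈
... | inj₁ refl | inj₁ refl = consec-irrefl i
... | inj₁ refl | inj₂ refl = ¬xy
... | inj₂ refl | inj₁ refl = ¬yx
... | inj₂ refl | inj₂ refl = consec-irrefl i

module _ {n : ℕ} where

  -- The proofs are recomputed, so that a vertex depends only on its underlying set.
  vertex : (A : Subset n) → .(∣ A ∣ ≡ 2) → .(Stable n A) → V (SG n 2)
  vertex A ∣A∣≡2 stable = A , recompute (∣ A ∣ ℕ.≟ 2) ∣A∣≡2 , recompute (stable? A) stable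

  colourOf : (V (SG n 2) → ℕ) → (A : Subset n) → Dec (∣ A ∣ ≡ 2) → Dec (Stable n A) → ℕ
  colourOf c A (yes ∣A∣≡2) (yes stable) = c (A , ∣A∣≡2 , stable)
  colourOf c A _           _            = 0

  colourOf-recompute : ∀ c (A : Subset n) ∣A∣≡2? stable? →
                       .(∣A∣≡2 : ∣ A ∣ ≡ 2) .(stable : Stable n A) →
                       colourOf c A ∣A∣≡2? stable? ≡ c (A , recompute ∣A∣≡2? ∣A∣≡2 , recompute stable? stable)
  colourOf-recompute c A (yes _) (yes _) _      _      = refl
  colourOf-recompute c A (no ¬e) _       ∣A∣≡2  _      = ⊥-elim-irr (¬e ∣A∣≡2)
  colourOf-recompute c A (yes _) (no ¬s) _      stable = ⊥-elim-irr (¬s stable)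

  setColour : (V (SG n 2) → ℕ) → Subset n → ℕ
  setColour c A = colourOf c A (∣ A ∣ ℕ.≟ 2) (stable? A)

  pairVertex : (p : Pair n) → .(Apart p) → V (SG n 2)
  pairVertex p a = vertex (pairSet p) (∣pairSet∣≡2 (proj₁ a)) (stable-pairSet a)

  setColour-pairVertex : ∀ c {p} (a : Apart p) → setColour c (pairSet p) ≡ c (pairVertex p a)
  setColour-pairVertex c {p} a =
    colourOf-recompute c (pairSet p) (∣ pairSet p ∣ ℕ.≟ 2) (stable? _) (∣pairSet∣≡2 (proj₁ a)) (stable-pairSet a)

  pairVertex-adj : ∀ {p q : Pair n} .(a : Apart p) .(b : Apart q) →
                   DisjointPairs p q → Adj (SG n 2) (pairVertex p a) (pairVertex q b)
  pairVertex-adj {x , y} {x′ , y′} _ _ (x∉q , y∉q) i i∈p i∈q with ∈-pairSet⁻ i∈p | ∈-pairSet⁻ i∈q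
  ... | inj₁ refl | inj₁ refl = proj₁ x∉q refl
  ... | inj₁ refl | inj₂ refl = proj₂ x∉q refl
  ... | inj₂ refl | inj₁ refl = proj₁ y∉q refl
  ... | inj₂ refl | inj₂ refl = proj₂ y∉q refl

  pairColouring : (c : V (SG n 2) → ℕ) → Proper (SG n 2) c → PairColouring n
  pairColouring c c-proper = record
    { colour    = setColour c ∘ pairSet
    ; symmetric = λ x y → cong (setColour c) (∪-comm ⁅ x ⁆ ⁅ y ⁆)
    ; proper    = λ {p} {q} a b p#q same →
        c-proper (pairVertex p a) (pairVertex q b) (pairVertex-adj a b p#q)
          (trans (sym (setColour-pairVertex c a)) (trans same (setColour-pairVertex c b)))
    }

rainbowNeighbourhood : ∀ k (c : V (SG (4 + k) 2) → ℕ) → Proper (SG (4 + k) 2) c →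
                       Σ (V (SG (4 + k) 2)) λ v → NbrColoursAtLeast (SG (4 + k) 2) c v (suc k)
rainbowNeighbourhood k c c-proper with rainbowStar k (pairColouring c c-proper)
... | w , a , R =
  pairVertex (zero , w) a , neighbour , (λ i → pairVertex-adj a (apart R i) (disjoint R i)) , distinct
  where
  neighbour : Fin (suc k) → V (SG (4 + k) 2)
  neighbour i = pairVertex (pair R i) (apart R i)
  distinct : ∀ i j → c (neighbour i) ≡ c (neighbour j) → i ≡ j
  distinct i j same = injective R i j
    (trans (setColour-pairVertex c (apart R i)) (trans same (sym (setColour-pairVertex c (apart R j)))))

-- Colouring by least element

minimum : ∀ {n} → Subset n → ℕ
minimum []            = 0
minimum (inside  ∷ p) = 0
minimum (outside ∷ p) = suc (minimum p)

minimum-≤ : ∀ {n} {p : Subset n} {x} → x ∈ p → minimum p ≤ toℕ x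
minimum-≤ {p = inside  ∷ p} _           = z≤n
minimum-≤ {p = outside ∷ p} (there x∈p) = s≤s (minimum-≤ x∈p)

minimum-∈ : ∀ {n} {p : Subset n} {x} → x ∈ p → ∃ λ y → y ∈ p × toℕ y ≡ minimum p
minimum-∈ {p = inside  ∷ p} _           = zero , here , refl
minimum-∈ {p = outside ∷ p} (there x∈p) =
  let y , y∈p , y≡min = minimum-∈ x∈p in suc y , there y∈p , cong suc y≡min

member-≢ : ∀ {n} {p : Subset n} → 2 ≤ ∣ p ∣ → (x : Fin n) → ∃ λ y → y ∈ p × y ≢ x
member-≢ {p = p} 2≤∣p∣ x with any? (λ y → y ∈? p ×-dec ¬? (y Fin.≟ x))
... | yes found = found
... | no none   =
  contradiction (ℕ.≤-trans 2≤∣p∣ (ℕ.≤-trans (p⊆q⇒∣p∣≤∣q∣ p⊆⁅x⁆) (ℕ.≤-reflexive (∣⁅x⁆∣≡1 x)))) λ { (s≤s ()) }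
  where
  p⊆⁅x⁆ : p ⊆ ⁅ x ⁆
  p⊆⁅x⁆ {y} y∈p with y Fin.≟ x
  ... | yes refl = x∈⁅x⁆ x
  ... | no y≢x   = contradiction (y , y∈p , y≢x) none

toℕ≮⇒last-two : ∀ {m} (x : Fin (2 + m)) → ¬ toℕ x < m → toℕ x ≡ m ⊎ toℕ x ≡ suc m
toℕ≮⇒last-two x x≮m with ℕ.m≤n⇒m<n∨m≡n (ℕ.s≤s⁻¹ (toℕ<n x))
... | inj₁ x<1+m = inj₁ (ℕ.≤-antisym (ℕ.s≤s⁻¹ x<1+m) (ℕ.≮⇒≥ x≮m))
... | inj₂ x≡1+m = inj₂ x≡1+m

last-two-consec : ∀ {m} {x y : Fin (2 + m)} → x ≢ y → ¬ toℕ x < m → ¬ toℕ y < m →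
                  CycConsec (2 + m) x y ⊎ CycConsec (2 + m) y x
last-two-consec {x = x} {y} x≢y x≮m y≮m with toℕ≮⇒last-two x x≮m | toℕ≮⇒last-two y y≮m
... | inj₁ x≡m   | inj₁ y≡m   = contradiction (toℕ-injective (trans x≡m (sym y≡m))) x≢y
... | inj₁ x≡m   | inj₂ y≡1+m = inj₁ (inj₁ (trans (cong suc x≡m) (sym y≡1+m)))
... | inj₂ x≡1+m | inj₁ y≡m   = inj₂ (inj₁ (trans (cong suc y≡m) (sym x≡1+m)))
... | inj₂ x≡1+m | inj₂ y≡1+m = contradiction (toℕ-injective (trans x≡1+m (sym y≡1+m))) x≢y

stable-∈-initial : ∀ {m} {A : Subset (2 + m)} → 2 ≤ ∣ A ∣ → Stable (2 + m) A → ∃ λ x → x ∈ A × toℕ x < m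
stable-∈-initial {m} 2≤∣A∣ stable with member-≢ 2≤∣A∣ zero
... | x , x∈A , _ with member-≢ 2≤∣A∣ x
...   | y , y∈A , y≢x with toℕ x ℕ.<? m | toℕ y ℕ.<? m
...     | yes x<m | _       = x , x∈A , x<m
...     | no _    | yes y<m = y , y∈A , y<m
...     | no x≮m  | no y≮m  =
  ⊥-elim ([ stable x y x∈A y∈A , stable y x y∈A x∈A ]′ (last-two-consec (y≢x ∘ sym) x≮m y≮m))

minColour : ∀ {m} → V (SG (2 + m) 2) → Fin m
minColour (A , ∣A∣≡2 , stable) =
  let x , x∈A , x<m = stable-∈-initial (ℕ.≤-reflexive (sym ∣A∣≡2)) stable
  in fromℕ< (ℕ.≤-<-trans (minimum-≤ x∈A) x<m)

minColour-∈ : ∀ {m} (v : V (SG (2 + m) 2)) → ∃ λ y → y ∈ proj₁ v × toℕ y ≡ toℕ (minColour v)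
minColour-∈ (A , ∣A∣≡2 , stable) =
  let x , x∈A , _ = stable-∈-initial (ℕ.≤-reflexive (sym ∣A∣≡2)) stable
      y , y∈A , y≡min = minimum-∈ x∈A
  in y , y∈A , trans y≡min (sym (toℕ-fromℕ< _))

minColour-proper : ∀ {m} → Proper (SG (2 + m) 2) minColour
minColour-proper u v u#v same =
  let x , x∈u , x≡ = minColour-∈ u
      y , y∈v , y≡ = minColour-∈ v
      y≡x = toℕ-injective (trans y≡ (trans (cong toℕ (sym same)) (sym x≡)))
  in u#v x x∈u (subst (_∈ proj₁ v) y≡x y∈v)

proposition2p4 : (n : ℕ) → 4 ≤ n →
    IsLocalChromaticNumber (SG n 2) (n ∸ 2) × IsChromaticNumber (SG n 2) (n ∸ 2)
proposition2p4 (suc (suc (suc (suc k)))) (s≤s (s≤s (s≤s (s≤s _)))) =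
  ( (toℕ ∘ minColour , toℕ-proper G minColour-proper ,
       λ v → suc k , ℕ.≤-refl , nbrColoursAtMost-Fin G minColour minColour-proper v)
  , λ c c-proper → let v , rainbow = rainbowNeighbourhood k c c-proper in v , suc k , ℕ.≤-refl , rainbow )
  , (minColour , minColour-proper)
  , λ j c c-proper →
      let v , rainbow = rainbowNeighbourhood k (toℕ ∘ c) (toℕ-proper G c-proper)
      in nbrColoursAtLeast⇒≤ G c c-proper v rainbow
  where
  G : Graph
  G = SG (4 + k) 2
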